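{- Let $I=\{i_1,i_2,\ldots\}$ (with $i_1<i_2<\cdots$) be an interval of $\mathbb N$, let $i_0=i_1-1$, and let $\mu$ be a $0$-$1$ sequence on $I$. (1) If $\mu\notin\{011,100,001,110\}$, then $G_\mu$ has at most one nontrivial module. (2) If $M$ is a nontrivial module of $G_\mu$, then either $M=I$ or $M=(\{i_0\}\cup I)\setminus\{i_1\}$, or else $I$ is finite, $I=\{i_1,\ldots,i_n\}$, and $M=\{i_0,i_n\}$ or $M=\{i_1,i_n\}$.
   Context: $G_\mu$ is the graph with vertex set $\{i_0\}\cup I$ in which, for vertices $i<j$, $\{i,j\}$ is an edge iff either ($\mu(j)=1$ and $j=i+1$) or ($\mu(j)=0$ and $j\neq i+1$). A module of a graph is a vertex set $M$ such that each vertex outside $M$ is adjacent to all or to none of the vertices of $M$; the empty set, singletons and the whole vertex set are trivial modules, all others are nontrivial. In (1), $\mu$ is viewed as a word $\mu(i_1)\mu(i_2)\cdots$. -}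

module Defs where

open import Data.Nat using (ℕ; zero; suc; _+_; _≤_; _<_)
open import Data.Bool using (Bool; true; false)
open import Data.Maybe using (Maybe; just; nothing)
open import Data.Product using (_×_; Σ; ∃)
open import Data.Sum using (_⊎_)
open import Data.Unit using (⊤)
open import Data.Empty using (⊥)
open import Relation.Nullary using (¬_)
open import Relation.Binary.PropositionalEquality using (_≡_; _≢_)
open import Function.Bundles using (_⇔_)

-- The interval I ⊆ ℕ is given by i0 : ℕ (so i1 = suc i0 is its least
-- element) and an upper bound  ub : Maybe ℕ :
--   ub = nothing  : I = { i1, i1+1, ... }        (infinite)
--   ub = just n   : I = { i1, ..., n }  with i1 ≤ n (finite, i_n = n).
-- A 0-1 sequence μ on I is a function ℕ → Bool (true = 1, false = 0);
-- only its values on I matter.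

WellFormed : ℕ → Maybe ℕ → Set
WellFormed i0 nothing  = ⊤
WellFormed i0 (just n) = suc i0 ≤ n

Below : Maybe ℕ → ℕ → Set
Below nothing  x = ⊤
Below (just n) x = x ≤ n

InI : ℕ → Maybe ℕ → ℕ → Set
InI i0 ub x = suc i0 ≤ x × Below ub x

InV : ℕ → Maybe ℕ → ℕ → Set
InV i0 ub x = i0 ≤ x × Below ub x

EdgeUp : (ℕ → Bool) → ℕ → ℕ → Set
EdgeUp μ i j = (μ j ≡ true × j ≡ suc i) ⊎ (μ j ≡ false × j ≢ suc i)

-- adjacency in G_μ (vertex-set membership is imposed separately)
Adj : (ℕ → Bool) → ℕ → ℕ → Set
Adj μ x y = (x < y × EdgeUp μ x y) ⊎ (y < x × EdgeUp μ y x)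

Subset : Set
Subset = ℕ → Bool

_∈_ : ℕ → Subset → Set
x ∈ M = M x ≡ true

IsModule : ℕ → Maybe ℕ → (ℕ → Bool) → Subset → Set
IsModule i0 ub μ M =
  (∀ x → x ∈ M → InV i0 ub x) ×
  (∀ v → InV i0 ub v → ¬ (v ∈ M) →
     (∀ m → m ∈ M → Adj μ v m) ⊎ (∀ m → m ∈ M → ¬ Adj μ v m))

IsEmpty : Subset → Set
IsEmpty M = ∀ x → ¬ (x ∈ M)

IsSingleton : Subset → Set
IsSingleton M = ∃ λ a → ∀ x → (x ∈ M) ⇔ (x ≡ a)

IsWhole : ℕ → Maybe ℕ → Subset → Set
IsWhole i0 ub M = ∀ x → (x ∈ M) ⇔ InV i0 ub x

IsTrivial : ℕ → Maybe ℕ → Subset → Set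
IsTrivial i0 ub M = IsEmpty M ⊎ IsSingleton M ⊎ IsWhole i0 ub M

NontrivialModule : ℕ → Maybe ℕ → (ℕ → Bool) → Subset → Set
NontrivialModule i0 ub μ M = IsModule i0 ub μ M × ¬ IsTrivial i0 ub M

ExcWord : Bool → Bool → Bool → Set
ExcWord false true  true  = ⊤
ExcWord true  false false = ⊤
ExcWord false false true  = ⊤
ExcWord true  true  false = ⊤
ExcWord _     _     _     = ⊥

Exceptional : ℕ → Maybe ℕ → (ℕ → Bool) → Set
Exceptional i0 ub μ =
  ub ≡ just (i0 + 3) × ExcWord (μ (i0 + 1)) (μ (i0 + 2)) (μ (i0 + 3))

SameAs : Subset → (ℕ → Set) → Set
SameAs M P = ∀ x → (x ∈ M) ⇔ P x

-- In G_μ the adjacency of i < j is decided by μ j: j sees i iff μ j = 1 when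
-- i = j - 1, and iff μ j = 0 otherwise.  A vertex outside a module M sees any two
-- members alike, so each such vertex yields an equation between values of μ and
-- their negations.  A module containing a < w
-- also contains w + 1 (w + 1 sees w as its predecessor and a from afar), so it is
-- upward closed from its second element; and above two non-members u < c there
-- is at most one member, which (if some member lies below c) must be the last
-- vertex.  Splitting on which of i₀, i₁, i₂ belong to M yields exactly the four
-- shapes of (2).  For (1), any two different shapes give contradictory equations,
-- except when |I| = 3, where the equations force μ ∈ {011, 100, 001, 110}.
module Submission where

open import Defs
open import Data.Nat using (ℕ; suc; _≤_; _<_; s≤s)
open import Data.Nat.Properties
  using (≤-refl; ≤-trans; ≤-antisym; <-trans; <⇒≤; <-≤-trans; n≤1+n; n<1+n; 1+n≰n; <⇒≱; <⇒≢; >⇒≢;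
         ≤∧≮⇒≡; ≤∧≢⇒<; m≤n+m; m≤n⇒m≤1+n; m<n⇒m<1+n; m≤n⇒m<n∨m≡n; ≤-<-connex; <-cmp; +-comm)
open import Data.Bool using (Bool; true; false; not)
import Data.Bool.Properties as Bool
open import Data.Maybe using (Maybe; just; nothing)
open import Data.Maybe.Properties using (just-injective)
open import Data.Product using (_×_; ∃; _,_; proj₁; proj₂)
open import Data.Sum using (_⊎_; inj₁; inj₂; [_,_])
import Data.Sum as Sum
open import Data.Unit using (tt)
open import Data.Empty using (⊥; ⊥-elim)
open import Function using (_∘_; id)
open import Function.Bundles using (_⇔_; mk⇔; Equivalence)
open import Function.Construct.Composition using (_⇔-∘_)
open import Function.Construct.Symmetry using (⇔-sym)
open import Relation.Binary.Definitions using (tri<; tri≈; tri>)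
open import Relation.Binary.PropositionalEquality using (_≡_; _≢_; refl; sym; cong; subst)
open import Relation.Nullary using (¬_; Dec; yes; no; contradiction)
open import Relation.Nullary.Decidable using (decidable-stable)

open Equivalence using (to; from)

≡true-⇔⇒≡ : ∀ {p q : Bool} → (p ≡ true) ⇔ (q ≡ true) → p ≡ q
≡true-⇔⇒≡ {false} {false} _ = refl
≡true-⇔⇒≡ {false} {true}  e = from e refl
≡true-⇔⇒≡ {true}  {false} e = sym (to e refl)
≡true-⇔⇒≡ {true}  {true}  _ = refl

Below-downward : ∀ ub {x y} → x ≤ y → Below ub y → Below ub x
Below-downward nothing  _   _   = tt
Below-downward (just n) x≤y y≤n = ≤-trans x≤y y≤n

InV-downward : ∀ {i0 ub x y} → i0 ≤ x → x ≤ y → InV i0 ub y → InV i0 ub x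
InV-downward {ub = ub} i0≤x x≤y (_ , y-below) = i0≤x , Below-downward ub x≤y y-below

InV-between : ∀ {i0 ub x y z} → InV i0 ub x → InV i0 ub z → x ≤ y → y ≤ z → InV i0 ub y
InV-between (i0≤x , _) z∈V x≤y y≤z = InV-downward (≤-trans i0≤x x≤y) y≤z z∈V

WellFormed⇒i₁∈V : ∀ {i0 ub} → WellFormed i0 ub → InV i0 ub (suc i0)
WellFormed⇒i₁∈V {ub = nothing} _    = n≤1+n _ , tt
WellFormed⇒i₁∈V {ub = just n}  i₁≤n = n≤1+n _ , i₁≤n

last-vertex : ∀ {i0} ub {x} → InV i0 ub x → ¬ InV i0 ub (suc x) → ub ≡ just x
last-vertex nothing  (i0≤x , _)   x+1∉V = contradiction (≤-trans i0≤x (n≤1+n _) , tt) x+1∉V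
last-vertex (just n) (i0≤x , x≤n) x+1∉V =
  cong just (sym (≤∧≮⇒≡ x≤n (λ x<n → x+1∉V (≤-trans i0≤x (n≤1+n _) , x<n))))

vertex-cases : ∀ {i0 x} → i0 ≤ x → x ≡ i0 ⊎ x ≡ suc i0 ⊎ suc (suc i0) ≤ x
vertex-cases i0≤x with m≤n⇒m<n∨m≡n i0≤x
... | inj₂ refl = inj₁ refl
... | inj₁ i₁≤x with m≤n⇒m<n∨m≡n i₁≤x
...   | inj₂ refl = inj₂ (inj₁ refl)
...   | inj₁ i₂≤x = inj₂ (inj₂ i₂≤x)

adj-comm : ∀ {μ x y} → Adj μ x y ⇔ Adj μ y x
adj-comm = mk⇔ Sum.swap Sum.swap

adj-next : ∀ μ i → Adj μ i (suc i) ⇔ (μ (suc i) ≡ true)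
adj-next μ i = mk⇔ reading (λ μ≡1 → inj₁ (≤-refl , inj₁ (μ≡1 , refl)))
  where
  reading : Adj μ i (suc i) → μ (suc i) ≡ true
  reading (inj₁ (_ , inj₁ (μ≡1 , _)))     = μ≡1
  reading (inj₁ (_ , inj₂ (_ , i+1≢i+1))) = contradiction refl i+1≢i+1
  reading (inj₂ (i+1<i , _))             = contradiction (n≤1+n i) (<⇒≱ i+1<i)

adj-prev : ∀ μ i → Adj μ (suc i) i ⇔ (μ (suc i) ≡ true)
adj-prev μ i = adj-next μ i ⇔-∘ adj-comm {μ}

adj-far-above : ∀ μ {i j} → suc (suc i) ≤ j → Adj μ i j ⇔ (not (μ j) ≡ true)
adj-far-above μ {i} {j} i+2≤j =
  mk⇔ reading (λ ¬μ≡1 → inj₁ (i<j , inj₂ (Bool.not-injective ¬μ≡1 , j≢i+1)))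
  where
  i<j : i < j
  i<j = ≤-trans (n≤1+n _) i+2≤j
  j≢i+1 : j ≢ suc i
  j≢i+1 refl = 1+n≰n i+2≤j
  reading : Adj μ i j → not (μ j) ≡ true
  reading (inj₁ (_ , inj₁ (_ , j≡i+1))) = contradiction j≡i+1 j≢i+1
  reading (inj₁ (_ , inj₂ (μ≡0 , _)))  = cong not μ≡0
  reading (inj₂ (j<i , _))             = contradiction (<⇒≤ i<j) (<⇒≱ j<i)

adj-far-below : ∀ μ {i j} → suc (suc i) ≤ j → Adj μ j i ⇔ (not (μ j) ≡ true)
adj-far-below μ i+2≤j = adj-far-above μ i+2≤j ⇔-∘ adj-comm {μ}

_∈?_ : ∀ x (M : Subset) → Dec (x ∈ M)
x ∈? M = M x Bool.≟ true

singleton : ∀ {M a} → a ∈ M → (∀ x → x ∈ M → x ≡ a) → IsSingleton M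
singleton {a = a} a∈M only-a = a , λ x → mk⇔ (only-a x) (λ { refl → a∈M })

sameAs-∈ : ∀ {M P x} → SameAs M P → P x → x ∈ M
sameAs-∈ {x = x} M≈P = from (M≈P x)

sameAs-∉ : ∀ {M P x} → SameAs M P → ¬ P x → ¬ x ∈ M
sameAs-∉ {x = x} M≈P ¬Px = ¬Px ∘ to (M≈P x)

sameAs-unique : ∀ {M N P} → SameAs M P → SameAs N P → ∀ x → M x ≡ N x
sameAs-unique M≈P N≈P x = ≡true-⇔⇒≡ (⇔-sym (N≈P x) ⇔-∘ M≈P x)

PairWith : ℕ → ℕ → ℕ → Set
PairWith a n x = x ≡ a ⊎ x ≡ n

InVExcept : ℕ → Maybe ℕ → ℕ → ℕ → Set
InVExcept i0 ub v x = InV i0 ub x × x ≢ v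

InI⇔InVExcept-i₀ : ∀ {i0 ub x} → InI i0 ub x ⇔ InVExcept i0 ub i0 x
InI⇔InVExcept-i₀ = mk⇔ (λ (i₁≤x , x-below) → (≤-trans (n≤1+n _) i₁≤x , x-below) , >⇒≢ i₁≤x)
                       (λ ((i0≤x , x-below) , x≢i₀) → ≤∧≢⇒< i0≤x (x≢i₀ ∘ sym) , x-below)

others-last⇒pair : ∀ {M a c} ub → a ∈ M → ¬ IsSingleton M →
                   (∀ x → x ∈ M → x ≡ a ⊎ (c < x × ub ≡ just x)) →
                   ∃ λ n → ub ≡ just n × c < n × SameAs M (PairWith a n)
others-last⇒pair nothing a∈M non-singleton members =
  ⊥-elim (non-singleton (singleton a∈M λ x x∈M → [ id , (λ ()) ∘ proj₂ ] (members x x∈M)))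
others-last⇒pair {M} {a} {c} (just n) a∈M non-singleton members =
  n , refl , c<n , λ x → mk⇔ a-or-n (λ { (inj₁ refl) → a∈M ; (inj₂ refl) → n∈M })
  where
  a-or-n : ∀ {x} → x ∈ M → PairWith a n x
  a-or-n {x} x∈M = Sum.map₂ (sym ∘ just-injective ∘ proj₂) (members x x∈M)
  n-must-differ : ¬ (∀ {x} → x ≡ n → x ∈ M → x ≡ a)
  n-must-differ n-is-a =
    non-singleton (singleton a∈M λ x x∈M → [ id , (λ x≡n → n-is-a x≡n x∈M) ] (a-or-n x∈M))
  n∈M : n ∈ M
  n∈M = decidable-stable (n ∈? M) λ n∉M → n-must-differ λ { refl x∈M → contradiction x∈M n∉M }
  c<n : c < n
  c<n with members n n∈M
  ... | inj₁ n≡a       = contradiction (λ { refl _ → n≡a }) n-must-differ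
  ... | inj₂ (c<n , _) = c<n

module _ {i0 : ℕ} {ub : Maybe ℕ} {μ : ℕ → Bool} {M : Subset} (isModule : IsModule i0 ub μ M) where

  ∈⇒InV : ∀ {x} → x ∈ M → InV i0 ub x
  ∈⇒InV = proj₁ isModule _

  agree : ∀ {v a b} → InV i0 ub v → ¬ v ∈ M → a ∈ M → b ∈ M → Adj μ v a ⇔ Adj μ v b
  agree {v} v∈V v∉M a∈M b∈M with proj₂ isModule v v∈V v∉M
  ... | inj₁ adj-all  = mk⇔ (λ _ → adj-all _ b∈M) (λ _ → adj-all _ a∈M)
  ... | inj₂ adj-none = mk⇔ (⊥-elim ∘ adj-none _ a∈M) (⊥-elim ∘ adj-none _ b∈M)

  reads-alike : ∀ {v a b p q} → InV i0 ub v → ¬ v ∈ M → a ∈ M → b ∈ M →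
                Adj μ v a ⇔ (p ≡ true) → Adj μ v b ⇔ (q ≡ true) → p ≡ q
  reads-alike v∈V v∉M a∈M b∈M read-a read-b =
    ≡true-⇔⇒≡ (read-b ⇔-∘ (agree v∈V v∉M a∈M b∈M ⇔-∘ ⇔-sym read-a))

  suc-closed : ∀ {a w} → a ∈ M → w ∈ M → a < w → InV i0 ub (suc w) → suc w ∈ M
  suc-closed {a} {w} a∈M w∈M a<w w+1∈V = decidable-stable (suc w ∈? M) λ w+1∉M →
    Bool.not-¬ refl (sym (reads-alike w+1∈V w+1∉M a∈M w∈M (adj-far-below μ (s≤s a<w)) (adj-prev μ w)))

  upward-closed : ∀ {a m x} → a ∈ M → m ∈ M → a < m → InV i0 ub x → m ≤ x → x ∈ M
  upward-closed a∈M m∈M a<m x∈V m≤x with m≤n⇒m<n∨m≡n m≤x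
  ... | inj₂ refl                = m∈M
  ... | inj₁ (s≤s {n = w} m≤w) = suc-closed a∈M w∈M (<-≤-trans a<m m≤w) x∈V
    where
    w∈M : w ∈ M
    w∈M = upward-closed a∈M m∈M a<m
            (InV-downward (≤-trans (proj₁ (∈⇒InV a∈M)) (≤-trans (<⇒≤ a<m) m≤w)) (n≤1+n _) x∈V) m≤w

  -- u reads μ (suc w) = μ y, whereas w, the predecessor of suc w, reads μ (suc w) ≠ μ y.
  gap-then-member-is-last : ∀ {u w y} → InV i0 ub u → InV i0 ub w → ¬ u ∈ M → ¬ w ∈ M → u < w →
                            suc w ∈ M → y ∈ M → suc w < y → ⊥
  gap-then-member-is-last {u} {w} {y} u∈V w∈V u∉M w∉M u<w w+1∈M y∈M w+1<y =
    Bool.not-¬ (Bool.not-injective read-u) read-w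
    where
    read-u : not (μ (suc w)) ≡ not (μ y)
    read-u = reads-alike u∈V u∉M w+1∈M y∈M
               (adj-far-above μ (s≤s u<w)) (adj-far-above μ (<-trans (s≤s u<w) w+1<y))
    read-w : μ (suc w) ≡ not (μ y)
    read-w = reads-alike w∈V w∉M w+1∈M y∈M (adj-next μ w) (adj-far-above μ w+1<y)

  -- Descend from x to the highest non-member below it.
  no-two-above-gap : ∀ {u c x y} → InV i0 ub u → ¬ u ∈ M → ¬ c ∈ M → u < c →
                     x ∈ M → y ∈ M → c < x → x < y → ⊥
  no-two-above-gap {u} {c} {y = y} u∈V u∉M c∉M u<c x∈M y∈M (s≤s {n = w} c≤w) x<y
    with m≤n⇒m<n∨m≡n c≤w
  ... | inj₂ refl = gap-then-member-is-last u∈V w∈V u∉M c∉M u<c x∈M y∈M x<y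
    where
    w∈V : InV i0 ub w
    w∈V = InV-between u∈V (∈⇒InV y∈M) (<⇒≤ u<c) (<⇒≤ (<-trans (n<1+n w) x<y))
  ... | inj₁ c<w with w ∈? M
  ...   | yes w∈M = no-two-above-gap u∈V u∉M c∉M u<c w∈M x∈M c<w (n<1+n w)
  ...   | no  w∉M = gap-then-member-is-last u∈V w∈V u∉M w∉M (<-trans u<c c<w) x∈M y∈M x<y
    where
    w∈V : InV i0 ub w
    w∈V = InV-between u∈V (∈⇒InV y∈M) (<⇒≤ (<-trans u<c c<w)) (<⇒≤ (<-trans (n<1+n w) x<y))

  above-gap-unique : ∀ {u c x y} → InV i0 ub u → ¬ u ∈ M → ¬ c ∈ M → u < c →
                     x ∈ M → y ∈ M → c < x → c < y → x ≡ y
  above-gap-unique u∈V u∉M c∉M u<c x∈M y∈M c<x c<y with <-cmp _ _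
  ... | tri< x<y _ _ = ⊥-elim (no-two-above-gap u∈V u∉M c∉M u<c x∈M y∈M c<x x<y)
  ... | tri≈ _ x≡y _ = x≡y
  ... | tri> _ _ y<x = ⊥-elim (no-two-above-gap u∈V u∉M c∉M u<c y∈M x∈M c<y y<x)

  above-gap-is-last : ∀ {u c a x} → InV i0 ub u → ¬ u ∈ M → ¬ c ∈ M → u < c →
                      a ∈ M → a < c → x ∈ M → c < x → ub ≡ just x
  above-gap-is-last u∈V u∉M c∉M u<c a∈M a<c x∈M c<x = last-vertex ub (∈⇒InV x∈M) λ x+1∈V →
    <⇒≢ (n<1+n _) (above-gap-unique u∈V u∉M c∉M u<c x∈M (suc-closed a∈M x∈M (<-trans a<c c<x) x+1∈V)
                     c<x (<-trans c<x (n<1+n _)))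

  pair-with-last : ∀ {u c a} → InV i0 ub u → ¬ u ∈ M → ¬ c ∈ M → u < c → a ∈ M → a < c →
                   (∀ {x} → x ∈ M → x ≤ c → x ≡ a) → ¬ IsSingleton M →
                   ∃ λ n → ub ≡ just n × c < n × SameAs M (PairWith a n)
  pair-with-last {c = c} {a} u∈V u∉M c∉M u<c a∈M a<c only-a-below non-singleton =
    others-last⇒pair ub a∈M non-singleton members
    where
    members : ∀ x → x ∈ M → x ≡ a ⊎ (c < x × ub ≡ just x)
    members x x∈M with ≤-<-connex x c
    ... | inj₁ x≤c = inj₁ (only-a-below x∈M x≤c)
    ... | inj₂ c<x = inj₂ (c<x , above-gap-is-last u∈V u∉M c∉M u<c a∈M a<c x∈M c<x)

  members-up-to-i₂ : ∀ {x} → x ∈ M → x ≤ suc (suc i0) → ¬ suc (suc i0) ∈ M → x ≡ i0 ⊎ x ≡ suc i0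
  members-up-to-i₂ x∈M x≤i₂ i₂∉M with vertex-cases (proj₁ (∈⇒InV x∈M))
  ... | inj₁ x≡i₀         = inj₁ x≡i₀
  ... | inj₂ (inj₁ x≡i₁) = inj₂ x≡i₁
  ... | inj₂ (inj₂ i₂≤x) = contradiction (subst (_∈ M) (≤-antisym x≤i₂ i₂≤x) x∈M) i₂∉M

  i₀,i₁∈⇒whole : i0 ∈ M → suc i0 ∈ M → IsWhole i0 ub M
  i₀,i₁∈⇒whole i₀∈M i₁∈M x = mk⇔ ∈⇒InV fill
    where
    fill : InV i0 ub x → x ∈ M
    fill x∈V with m≤n⇒m<n∨m≡n (proj₁ x∈V)
    ... | inj₂ refl = i₀∈M
    ... | inj₁ i₁≤x = upward-closed i₀∈M i₁∈M ≤-refl x∈V i₁≤x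

  i₀,i₂∈⇒all-but-i₁ : i0 ∈ M → ¬ suc i0 ∈ M → suc (suc i0) ∈ M → SameAs M (InVExcept i0 ub (suc i0))
  i₀,i₂∈⇒all-but-i₁ i₀∈M i₁∉M i₂∈M x = mk⇔ (λ x∈M → ∈⇒InV x∈M , λ { refl → i₁∉M x∈M }) fill
    where
    fill : InVExcept i0 ub (suc i0) x → x ∈ M
    fill (x∈V , x≢i₁) with vertex-cases (proj₁ x∈V)
    ... | inj₁ refl         = i₀∈M
    ... | inj₂ (inj₁ x≡i₁) = contradiction x≡i₁ x≢i₁
    ... | inj₂ (inj₂ i₂≤x) = upward-closed i₀∈M i₂∈M (s≤s (n≤1+n i0)) x∈V i₂≤x

  i₁,i₂∈⇒I : ¬ i0 ∈ M → suc i0 ∈ M → suc (suc i0) ∈ M → SameAs M (InI i0 ub)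
  i₁,i₂∈⇒I i₀∉M i₁∈M i₂∈M x = mk⇔ in-I fill
    where
    in-I : x ∈ M → InI i0 ub x
    in-I x∈M with m≤n⇒m<n∨m≡n (proj₁ (∈⇒InV x∈M))
    ... | inj₂ refl = contradiction x∈M i₀∉M
    ... | inj₁ i₁≤x = i₁≤x , proj₂ (∈⇒InV x∈M)
    fill : InI i0 ub x → x ∈ M
    fill (i₁≤x , x-below) with m≤n⇒m<n∨m≡n i₁≤x
    ... | inj₂ refl = i₁∈M
    ... | inj₁ i₂≤x = upward-closed i₁∈M i₂∈M ≤-refl (≤-trans (n≤1+n i0) i₁≤x , x-below) i₂≤x

  i₀∈,i₁,i₂∉⇒pair : InV i0 ub (suc i0) → i0 ∈ M → ¬ suc i0 ∈ M → ¬ suc (suc i0) ∈ M → ¬ IsSingleton M →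
                    ∃ λ n → ub ≡ just n × suc (suc i0) < n × SameAs M (PairWith i0 n)
  i₀∈,i₁,i₂∉⇒pair i₁∈V i₀∈M i₁∉M i₂∉M =
    pair-with-last i₁∈V i₁∉M i₂∉M ≤-refl i₀∈M (s≤s (n≤1+n i0)) λ x∈M x≤i₂ →
      [ id , (λ x≡i₁ → contradiction (subst (_∈ M) x≡i₁ x∈M) i₁∉M) ] (members-up-to-i₂ x∈M x≤i₂ i₂∉M)

  i₁∈,i₀,i₂∉⇒pair : ¬ i0 ∈ M → suc i0 ∈ M → ¬ suc (suc i0) ∈ M → ¬ IsSingleton M →
                    ∃ λ n → ub ≡ just n × suc (suc i0) < n × SameAs M (PairWith (suc i0) n)
  i₁∈,i₀,i₂∉⇒pair i₀∉M i₁∈M i₂∉M =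
    pair-with-last i₀∈V i₀∉M i₂∉M (s≤s (n≤1+n i0)) i₁∈M ≤-refl λ x∈M x≤i₂ →
      [ (λ x≡i₀ → contradiction (subst (_∈ M) x≡i₀ x∈M) i₀∉M) , id ] (members-up-to-i₂ x∈M x≤i₂ i₂∉M)
    where
    i₀∈V : InV i0 ub i0
    i₀∈V = InV-downward ≤-refl (n≤1+n i0) (∈⇒InV i₁∈M)

  i₀,i₁∉⇒subsingleton : InV i0 ub i0 → ¬ i0 ∈ M → ¬ suc i0 ∈ M → ∀ {x y} → x ∈ M → y ∈ M → x ≡ y
  i₀,i₁∉⇒subsingleton i₀∈V i₀∉M i₁∉M x∈M y∈M =
    above-gap-unique i₀∈V i₀∉M i₁∉M ≤-refl x∈M y∈M (above-i₁ x∈M) (above-i₁ y∈M)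
    where
    above-i₁ : ∀ {x} → x ∈ M → suc i0 < x
    above-i₁ x∈M with vertex-cases (proj₁ (∈⇒InV x∈M))
    ... | inj₁ refl         = contradiction x∈M i₀∉M
    ... | inj₂ (inj₁ refl) = contradiction x∈M i₁∉M
    ... | inj₂ (inj₂ i₂≤x) = i₂≤x

  consecutive-members-alike : ∀ {v m} → InV i0 ub v → ¬ v ∈ M → suc (suc v) ≤ m →
                              m ∈ M → suc m ∈ M → μ m ≡ μ (suc m)
  consecutive-members-alike v∈V v∉M v+2≤m m∈M m+1∈M = Bool.not-injective
    (reads-alike v∈V v∉M m∈M m+1∈M (adj-far-above μ v+2≤m) (adj-far-above μ (m≤n⇒m≤1+n v+2≤m)))

  split-consecutive-differ : ∀ {a m} → InV i0 ub m → ¬ m ∈ M → a ∈ M → suc m ∈ M →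
                             suc (suc a) ≤ m → μ m ≢ μ (suc m)
  split-consecutive-differ {m = m} m∈V m∉M a∈M m+1∈M a+2≤m μm≡μm+1 =
    Bool.not-¬ (sym μm≡μm+1) (sym reading)
    where
    reading : not (μ m) ≡ μ (suc m)
    reading = reads-alike m∈V m∉M a∈M m+1∈M (adj-far-below μ a+2≤m) (adj-next μ m)

-- The nontrivial modules listed in (2), together with the bound (i₂ ∈ V, resp. i₂ < n)
-- that nontriviality forces.
data Shape (i0 : ℕ) (ub : Maybe ℕ) (M : Subset) : Set where
  whole-I    : InV i0 ub (suc (suc i0)) → SameAs M (InI i0 ub) → Shape i0 ub M
  all-but-i₁ : InV i0 ub (suc (suc i0)) → SameAs M (InVExcept i0 ub (suc i0)) → Shape i0 ub M
  pair-i₀    : (∃ λ n → ub ≡ just n × suc (suc i0) < n × SameAs M (PairWith i0 n)) → Shape i0 ub M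
  pair-i₁    : (∃ λ n → ub ≡ just n × suc (suc i0) < n × SameAs M (PairWith (suc i0) n)) → Shape i0 ub M

classify : ∀ {i0 ub μ M} → WellFormed i0 ub → NontrivialModule i0 ub μ M → Shape i0 ub M
classify {i0} {ub} {μ} {M} wf (isM , nontrivial) with i0 ∈? M | suc i0 ∈? M | suc (suc i0) ∈? M
... | yes i₀∈M | yes i₁∈M | _        = ⊥-elim (nontrivial (inj₂ (inj₂ (i₀,i₁∈⇒whole isM i₀∈M i₁∈M))))
... | yes i₀∈M | no  i₁∉M | yes i₂∈M = all-but-i₁ (∈⇒InV isM i₂∈M) (i₀,i₂∈⇒all-but-i₁ isM i₀∈M i₁∉M i₂∈M)
... | yes i₀∈M | no  i₁∉M | no  i₂∉M =
  pair-i₀ (i₀∈,i₁,i₂∉⇒pair isM (WellFormed⇒i₁∈V wf) i₀∈M i₁∉M i₂∉M (nontrivial ∘ inj₂ ∘ inj₁))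
... | no  i₀∉M | yes i₁∈M | yes i₂∈M = whole-I (∈⇒InV isM i₂∈M) (i₁,i₂∈⇒I isM i₀∉M i₁∈M i₂∈M)
... | no  i₀∉M | yes i₁∈M | no  i₂∉M = pair-i₁ (i₁∈,i₀,i₂∉⇒pair isM i₀∉M i₁∈M i₂∉M (nontrivial ∘ inj₂ ∘ inj₁))
... | no  i₀∉M | no  i₁∉M | _        = ⊥-elim (nontrivial (inj₁ λ x x∈M →
  nontrivial (inj₂ (inj₁ (singleton x∈M λ y y∈M → i₀,i₁∉⇒subsingleton isM i₀∈V i₀∉M i₁∉M y∈M x∈M)))))
  where
  i₀∈V : InV i0 ub i0
  i₀∈V = InV-downward ≤-refl (n≤1+n i0) (WellFormed⇒i₁∈V wf)

ExcWord-011/100 : ∀ {a b c} → a ≡ not b → a ≡ not c → ExcWord a b c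
ExcWord-011/100 {true}  {false} {false} _ _ = tt
ExcWord-011/100 {false} {true}  {true}  _ _ = tt
ExcWord-011/100 {true}  {true}  ()
ExcWord-011/100 {false} {false} ()
ExcWord-011/100 {true}  {false} {true}  _ ()
ExcWord-011/100 {false} {true}  {false} _ ()

ExcWord-001/110 : ∀ {a b c} → a ≡ b → a ≡ not c → ExcWord a b c
ExcWord-001/110 {false} {false} {true}  _ _ = tt
ExcWord-001/110 {true}  {true}  {false} _ _ = tt
ExcWord-001/110 {true}  {false} ()
ExcWord-001/110 {false} {true}  ()
ExcWord-001/110 {false} {false} {false} _ ()
ExcWord-001/110 {true}  {true}  {true}  _ ()

-- Exceptional is phrased with i0 + k, which does not reduce to suc (… i0).
exceptional : ∀ {i0 μ} → ExcWord (μ (suc i0)) (μ (suc (suc i0))) (μ (suc (suc (suc i0)))) →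
              Exceptional i0 (just (suc (suc (suc i0)))) μ
exceptional {i0} word rewrite +-comm i0 1 | +-comm i0 2 | +-comm i0 3 = refl , word

I-of-length-three : ∀ {i0 μ M} → IsModule i0 (just (suc (suc (suc i0)))) μ M →
                    SameAs M (InI i0 (just (suc (suc (suc i0))))) →
                    Exceptional i0 (just (suc (suc (suc i0)))) μ
I-of-length-three {i0} {μ} {M} isM M≈I = exceptional {μ = μ} (ExcWord-011/100
  (reads-alike isM i₀∈V i₀∉M i₁∈M i₂∈M (adj-next μ i0) (adj-far-above μ ≤-refl))
  (reads-alike isM i₀∈V i₀∉M i₁∈M i₃∈M (adj-next μ i0) (adj-far-above μ (n≤1+n _))))
  where
  i₀∈V : InV i0 (just (suc (suc (suc i0)))) i0
  i₀∈V = ≤-refl , m≤n+m i0 3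
  i₀∉M : ¬ i0 ∈ M
  i₀∉M = sameAs-∉ M≈I (1+n≰n ∘ proj₁)
  i₁∈M : suc i0 ∈ M
  i₁∈M = sameAs-∈ M≈I (≤-refl , s≤s (m≤n+m i0 2))
  i₂∈M : suc (suc i0) ∈ M
  i₂∈M = sameAs-∈ M≈I (n≤1+n _ , s≤s (s≤s (n≤1+n i0)))
  i₃∈M : suc (suc (suc i0)) ∈ M
  i₃∈M = sameAs-∈ M≈I (s≤s (m≤n+m i0 2) , ≤-refl)

all-but-i₁-of-length-three : ∀ {i0 μ M} → IsModule i0 (just (suc (suc (suc i0)))) μ M →
                             SameAs M (InVExcept i0 (just (suc (suc (suc i0)))) (suc i0)) →
                             Exceptional i0 (just (suc (suc (suc i0)))) μ
all-but-i₁-of-length-three {i0} {μ} {M} isM M≈ = exceptional {μ = μ} (ExcWord-001/110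
  (reads-alike isM i₁∈V i₁∉M i₀∈M i₂∈M (adj-prev μ i0) (adj-next μ (suc i0)))
  (reads-alike isM i₁∈V i₁∉M i₀∈M i₃∈M (adj-prev μ i0) (adj-far-above μ ≤-refl)))
  where
  i₁∈V : InV i0 (just (suc (suc (suc i0)))) (suc i0)
  i₁∈V = n≤1+n i0 , s≤s (m≤n+m i0 2)
  i₁∉M : ¬ suc i0 ∈ M
  i₁∉M = sameAs-∉ M≈ λ (_ , i₁≢i₁) → i₁≢i₁ refl
  i₀∈M : i0 ∈ M
  i₀∈M = sameAs-∈ M≈ ((≤-refl , m≤n+m i0 3) , <⇒≢ (n<1+n i0))
  i₂∈M : suc (suc i0) ∈ M
  i₂∈M = sameAs-∈ M≈ ((m≤n+m i0 2 , s≤s (s≤s (n≤1+n i0))) , >⇒≢ (n<1+n (suc i0)))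
  i₃∈M : suc (suc (suc i0)) ∈ M
  i₃∈M = sameAs-∈ M≈ ((m≤n+m i0 3 , ≤-refl) , >⇒≢ (s≤s (m≤n+m (suc i0) 1)))

I-vs-all-but-i₁ : ∀ {i0 ub μ M N} → IsModule i0 ub μ M → IsModule i0 ub μ N → InV i0 ub (suc (suc i0)) →
                  SameAs M (InI i0 ub) → SameAs N (InVExcept i0 ub (suc i0)) → ⊥
I-vs-all-but-i₁ {i0} {ub} {μ} isM isN i₂∈V M≈I N≈ = Bool.not-¬ read-N read-M
  where
  i₁∈V : InV i0 ub (suc i0)
  i₁∈V = InV-downward (n≤1+n i0) (n≤1+n _) i₂∈V
  i₀∈V : InV i0 ub i0
  i₀∈V = InV-downward ≤-refl (n≤1+n i0) i₁∈V
  read-M : μ (suc i0) ≡ not (μ (suc (suc i0)))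
  read-M = reads-alike isM i₀∈V (sameAs-∉ M≈I (1+n≰n ∘ proj₁))
             (sameAs-∈ M≈I (≤-refl , proj₂ i₁∈V)) (sameAs-∈ M≈I (n≤1+n _ , proj₂ i₂∈V))
             (adj-next μ i0) (adj-far-above μ ≤-refl)
  read-N : μ (suc i0) ≡ μ (suc (suc i0))
  read-N = reads-alike isN i₁∈V (sameAs-∉ N≈ λ (_ , i₁≢i₁) → i₁≢i₁ refl)
             (sameAs-∈ N≈ (i₀∈V , <⇒≢ (n<1+n i0))) (sameAs-∈ N≈ (i₂∈V , >⇒≢ (n<1+n _)))
             (adj-prev μ i0) (adj-next μ (suc i0))

except-vs-pair : ∀ {i0 m v a μ M N} → IsModule i0 (just (suc m)) μ M → IsModule i0 (just (suc m)) μ N →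
                 SameAs M (InVExcept i0 (just (suc m)) v) → SameAs N (PairWith a (suc m)) →
                 i0 ≤ v → suc (suc v) ≤ m → suc (suc a) ≤ m → ⊥
except-vs-pair {i0} {m} {v} {a} {N = N} isM isN M≈ N≈ i0≤v v+2≤m a+2≤m =
  split-consecutive-differ isN m∈V m∉N (sameAs-∈ N≈ (inj₁ refl)) (sameAs-∈ N≈ (inj₂ refl)) a+2≤m
    (consecutive-members-alike isM v∈V (sameAs-∉ M≈ λ (_ , v≢v) → v≢v refl) v+2≤m
      (sameAs-∈ M≈ (m∈V , >⇒≢ v<m)) (sameAs-∈ M≈ (m+1∈V , >⇒≢ (m<n⇒m<1+n v<m))))
  where
  v<m : v < m
  v<m = ≤-trans (n≤1+n _) v+2≤m
  i0≤m : i0 ≤ m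
  i0≤m = ≤-trans i0≤v (<⇒≤ v<m)
  v∈V : InV i0 (just (suc m)) v
  v∈V = i0≤v , ≤-trans (<⇒≤ v<m) (n≤1+n m)
  m∈V : InV i0 (just (suc m)) m
  m∈V = i0≤m , n≤1+n m
  m+1∈V : InV i0 (just (suc m)) (suc m)
  m+1∈V = ≤-trans i0≤m (n≤1+n m) , ≤-refl
  m∉N : ¬ m ∈ N
  m∉N = sameAs-∉ N≈ [ >⇒≢ (≤-trans (n≤1+n _) a+2≤m) , <⇒≢ (n<1+n m) ]

I-vs-pair-i₀ : ∀ {i0 m μ M N} → IsModule i0 (just (suc m)) μ M → IsModule i0 (just (suc m)) μ N →
               SameAs M (InI i0 (just (suc m))) → SameAs N (PairWith i0 (suc m)) → suc (suc i0) ≤ m → ⊥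
I-vs-pair-i₀ isM isN M≈I N≈ i₂≤m =
  except-vs-pair isM isN (λ x → InI⇔InVExcept-i₀ ⇔-∘ M≈I x) N≈ ≤-refl i₂≤m i₂≤m

I-vs-pair-i₁ : ∀ {i0 m μ M N} → ¬ Exceptional i0 (just (suc m)) μ →
               IsModule i0 (just (suc m)) μ M → IsModule i0 (just (suc m)) μ N →
               SameAs M (InI i0 (just (suc m))) → SameAs N (PairWith (suc i0) (suc m)) →
               suc (suc i0) ≤ m → ⊥
I-vs-pair-i₁ ¬exceptional isM isN M≈I N≈ i₂≤m with m≤n⇒m<n∨m≡n i₂≤m
... | inj₁ i₃≤m = except-vs-pair isM isN (λ x → InI⇔InVExcept-i₀ ⇔-∘ M≈I x) N≈ ≤-refl i₂≤m i₃≤m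
... | inj₂ refl = ¬exceptional (I-of-length-three isM M≈I)

all-but-i₁-vs-pair-i₀ : ∀ {i0 m μ M N} → ¬ Exceptional i0 (just (suc m)) μ →
                        IsModule i0 (just (suc m)) μ M → IsModule i0 (just (suc m)) μ N →
                        SameAs M (InVExcept i0 (just (suc m)) (suc i0)) → SameAs N (PairWith i0 (suc m)) →
                        suc (suc i0) ≤ m → ⊥
all-but-i₁-vs-pair-i₀ {i0} ¬exceptional isM isN M≈ N≈ i₂≤m with m≤n⇒m<n∨m≡n i₂≤m
... | inj₁ i₃≤m = except-vs-pair isM isN M≈ N≈ (n≤1+n i0) i₃≤m i₂≤m
... | inj₂ refl = ¬exceptional (all-but-i₁-of-length-three isM M≈)

all-but-i₁-vs-i₁i₃ : ∀ {i0 μ M N} → IsModule i0 (just (suc (suc (suc i0)))) μ M →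
                     IsModule i0 (just (suc (suc (suc i0)))) μ N →
                     SameAs M (InVExcept i0 (just (suc (suc (suc i0)))) (suc i0)) →
                     SameAs N (PairWith (suc i0) (suc (suc (suc i0)))) → ⊥
all-but-i₁-vs-i₁i₃ {i0} {μ} isM isN M≈ N≈ = Bool.not-¬ read-N read-M
  where
  i₁∈V : InV i0 (just (suc (suc (suc i0)))) (suc i0)
  i₁∈V = n≤1+n i0 , s≤s (m≤n+m i0 2)
  i₂∈V : InV i0 (just (suc (suc (suc i0)))) (suc (suc i0))
  i₂∈V = m≤n+m i0 2 , n≤1+n _
  i₃∈V : InV i0 (just (suc (suc (suc i0)))) (suc (suc (suc i0)))
  i₃∈V = m≤n+m i0 3 , ≤-refl
  read-M : μ (suc (suc i0)) ≡ not (μ (suc (suc (suc i0))))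
  read-M = reads-alike isM i₁∈V (sameAs-∉ M≈ λ (_ , i₁≢i₁) → i₁≢i₁ refl)
             (sameAs-∈ M≈ (i₂∈V , >⇒≢ (n<1+n _))) (sameAs-∈ M≈ (i₃∈V , >⇒≢ (s≤s (m≤n+m (suc i0) 1))))
             (adj-next μ (suc i0)) (adj-far-above μ ≤-refl)
  read-N : μ (suc (suc i0)) ≡ μ (suc (suc (suc i0)))
  read-N = reads-alike isN i₂∈V (sameAs-∉ N≈ [ >⇒≢ (n<1+n _) , <⇒≢ (n<1+n _) ])
             (sameAs-∈ N≈ (inj₁ refl)) (sameAs-∈ N≈ (inj₂ refl))
             (adj-prev μ (suc i0)) (adj-next μ (suc (suc i0)))

all-but-i₁-vs-pair-i₁ : ∀ {i0 m μ M N} → IsModule i0 (just (suc m)) μ M → IsModule i0 (just (suc m)) μ N →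
                        SameAs M (InVExcept i0 (just (suc m)) (suc i0)) →
                        SameAs N (PairWith (suc i0) (suc m)) → suc (suc i0) ≤ m → ⊥
all-but-i₁-vs-pair-i₁ {i0} isM isN M≈ N≈ i₂≤m with m≤n⇒m<n∨m≡n i₂≤m
... | inj₁ i₃≤m = except-vs-pair isM isN M≈ N≈ (n≤1+n i0) i₃≤m i₃≤m
... | inj₂ refl = all-but-i₁-vs-i₁i₃ isM isN M≈ N≈

-- i₂ sees the last vertex the same way in both modules, yet tells i₀ (far) from i₁ (its predecessor).
pair-i₀-vs-pair-i₁ : ∀ {i0 n μ M N} → IsModule i0 (just n) μ M → IsModule i0 (just n) μ N →
                     SameAs M (PairWith i0 n) → SameAs N (PairWith (suc i0) n) → suc (suc i0) < n → ⊥
pair-i₀-vs-pair-i₁ {i0} {n} {μ} isM isN M≈ N≈ i₂<n =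
  Bool.not-¬ refl (sym (≡true-⇔⇒≡ reading))
  where
  i₂∈V : InV i0 (just n) (suc (suc i0))
  i₂∈V = m≤n+m i0 2 , <⇒≤ i₂<n
  reading : (not (μ (suc (suc i0))) ≡ true) ⇔ (μ (suc (suc i0)) ≡ true)
  reading = adj-prev μ (suc i0)
      ⇔-∘ (agree isN i₂∈V (sameAs-∉ N≈ [ >⇒≢ (n<1+n _) , <⇒≢ i₂<n ])
                  (sameAs-∈ N≈ (inj₂ refl)) (sameAs-∈ N≈ (inj₁ refl))
      ⇔-∘ (agree isM i₂∈V (sameAs-∉ M≈ [ >⇒≢ (s≤s (n≤1+n i0)) , <⇒≢ i₂<n ])
                  (sameAs-∈ M≈ (inj₁ refl)) (sameAs-∈ M≈ (inj₂ refl))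
      ⇔-∘ ⇔-sym (adj-far-below μ ≤-refl)))

shapes-agree : ∀ {i0 ub μ M N} → ¬ Exceptional i0 ub μ → IsModule i0 ub μ M → IsModule i0 ub μ N →
               Shape i0 ub M → Shape i0 ub N → ∀ x → M x ≡ N x
shapes-agree _ _ _ (whole-I _ M≈) (whole-I _ N≈) = sameAs-unique M≈ N≈
shapes-agree _ _ _ (all-but-i₁ _ M≈) (all-but-i₁ _ N≈) = sameAs-unique M≈ N≈
shapes-agree _ _ _ (pair-i₀ (n , refl , _ , M≈)) (pair-i₀ (.n , refl , _ , N≈)) = sameAs-unique M≈ N≈
shapes-agree _ _ _ (pair-i₁ (n , refl , _ , M≈)) (pair-i₁ (.n , refl , _ , N≈)) = sameAs-unique M≈ N≈
shapes-agree _ isM isN (whole-I i₂∈V M≈) (all-but-i₁ _ N≈) = ⊥-elim (I-vs-all-but-i₁ isM isN i₂∈V M≈ N≈)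
shapes-agree _ isM isN (all-but-i₁ _ M≈) (whole-I i₂∈V N≈) = ⊥-elim (I-vs-all-but-i₁ isN isM i₂∈V N≈ M≈)
shapes-agree _ isM isN (whole-I _ M≈) (pair-i₀ (_ , refl , s≤s i₂≤m , N≈)) =
  ⊥-elim (I-vs-pair-i₀ isM isN M≈ N≈ i₂≤m)
shapes-agree _ isM isN (pair-i₀ (_ , refl , s≤s i₂≤m , M≈)) (whole-I _ N≈) =
  ⊥-elim (I-vs-pair-i₀ isN isM N≈ M≈ i₂≤m)
shapes-agree ¬e isM isN (whole-I _ M≈) (pair-i₁ (_ , refl , s≤s i₂≤m , N≈)) =
  ⊥-elim (I-vs-pair-i₁ ¬e isM isN M≈ N≈ i₂≤m)
shapes-agree ¬e isM isN (pair-i₁ (_ , refl , s≤s i₂≤m , M≈)) (whole-I _ N≈) =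
  ⊥-elim (I-vs-pair-i₁ ¬e isN isM N≈ M≈ i₂≤m)
shapes-agree ¬e isM isN (all-but-i₁ _ M≈) (pair-i₀ (_ , refl , s≤s i₂≤m , N≈)) =
  ⊥-elim (all-but-i₁-vs-pair-i₀ ¬e isM isN M≈ N≈ i₂≤m)
shapes-agree ¬e isM isN (pair-i₀ (_ , refl , s≤s i₂≤m , M≈)) (all-but-i₁ _ N≈) =
  ⊥-elim (all-but-i₁-vs-pair-i₀ ¬e isN isM N≈ M≈ i₂≤m)
shapes-agree _ isM isN (all-but-i₁ _ M≈) (pair-i₁ (_ , refl , s≤s i₂≤m , N≈)) =
  ⊥-elim (all-but-i₁-vs-pair-i₁ isM isN M≈ N≈ i₂≤m)
shapes-agree _ isM isN (pair-i₁ (_ , refl , s≤s i₂≤m , M≈)) (all-but-i₁ _ N≈) =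
  ⊥-elim (all-but-i₁-vs-pair-i₁ isN isM N≈ M≈ i₂≤m)
shapes-agree _ isM isN (pair-i₀ (n , refl , i₂<n , M≈)) (pair-i₁ (.n , refl , _ , N≈)) =
  ⊥-elim (pair-i₀-vs-pair-i₁ isM isN M≈ N≈ i₂<n)
shapes-agree _ isM isN (pair-i₁ (n , refl , i₂<n , M≈)) (pair-i₀ (.n , refl , _ , N≈)) =
  ⊥-elim (pair-i₀-vs-pair-i₁ isN isM N≈ M≈ i₂<n)

mainTheorem19 : (i0 : ℕ) (ub : Maybe ℕ) (μ : ℕ → Bool) → WellFormed i0 ub →
    (¬ Exceptional i0 ub μ →
      ∀ M N → NontrivialModule i0 ub μ M → NontrivialModule i0 ub μ N →
        ∀ x → M x ≡ N x)
    ×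
    (∀ M → NontrivialModule i0 ub μ M →
      SameAs M (InI i0 ub)
      ⊎ SameAs M (λ x → InV i0 ub x × x ≢ suc i0)
      ⊎ (∃ λ n → ub ≡ just n ×
           (SameAs M (λ x → x ≡ i0 ⊎ x ≡ n)
            ⊎ SameAs M (λ x → x ≡ suc i0 ⊎ x ≡ n))))
mainTheorem19 i0 ub μ wf =
  (λ ¬exceptional M N M-nontrivial N-nontrivial →
     shapes-agree ¬exceptional (proj₁ M-nontrivial) (proj₁ N-nontrivial)
                  (classify wf M-nontrivial) (classify wf N-nontrivial)) ,
  (λ M M-nontrivial → describe (classify wf M-nontrivial))
  where
  describe : ∀ {M} → Shape i0 ub M →
    SameAs M (InI i0 ub) ⊎ SameAs M (InVExcept i0 ub (suc i0))
    ⊎ (∃ λ n → ub ≡ just n × (SameAs M (PairWith i0 n) ⊎ SameAs M (PairWith (suc i0) n)))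
  describe (whole-I _ M≈)                = inj₁ M≈
  describe (all-but-i₁ _ M≈)             = inj₂ (inj₁ M≈)
  describe (pair-i₀ (n , ub≡n , _ , M≈)) = inj₂ (inj₂ (n , ub≡n , inj₁ M≈))
  describe (pair-i₁ (n , ub≡n , _ , M≈)) = inj₂ (inj₂ (n , ub≡n , inj₂ M≈))
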